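{- Let $T$ be a MUL-tree, let $\ell$ be a label occurring on more than one leaf of $T$, and let $T'$ be the minimal subtree of $T$ spanning all leaves labeled $\ell$. Then any leaf of $T$ labeled $\ell$ that is attached to a pendant node having degree at least three in $T'$ is prunable.
   Context: A MUL-tree is a triple $(T,M,\psi)$, where $T$ is an unrooted tree with leaf set $\mathcal{L}(T)$ all of whose internal (non-leaf) nodes have degree at least three, $M$ is a finite set of labels, and $\psi:\mathcal{L}(T)\to M$ is surjective; we refer to it by $T$. A pendant node is an internal node that has a leaf as a neighbor. For an edge $(u,v)$, deleting it leaves subtrees $T_u^{uv}\ni u$ and $T_v^{uv}\ni v$; $M_u^{uv}$ is the set of labels on leaves of $T_u^{uv}$ but on no leaf of $T_v^{uv}$, and $M_v^{uv}$ symmetrically. A quartet of $T$ is an unordered bipartition $ab|cd$ of four distinct labels such that some edge $(u,v)$ has $\{a,b\}\subseteq M_u^{uv}$ and $\{c,d\}\subseteq M_v^{uv}$; $\Delta(u,v)$ is the set of such quartets at $(u,v)$, and the information content is $\mathcal{I}(T)=\bigcup_{(u,v)}\Delta(u,v)$. Prune$(v)$ for a leaf $v$ deletes $v$ (labels restricted to remaining leaves) and, if $v$'s neighbor $u$ becomes degree two, joins $u$'s two remaining neighbors by an edge and deletes $u$. A leaf is prunable if pruning it yields a tree with the same information content as $T$. -}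

module Defs where

open import Data.Nat using (ℕ; _≤_) renaming (_≟_ to _ℕ≟_)
open import Data.Bool using (Bool; true; false; _∧_; _∨_; not; if_then_else_)
open import Data.List using (List; []; _∷_; filterᵇ; map)
open import Data.Nat.ListAction using (sum)
open import Data.List.Membership.Propositional using (_∈_)
open import Data.List.Relation.Unary.Unique.Propositional using (Unique)
open import Data.Product using (Σ; ∃; _×_; _,_)
open import Data.Sum using (_⊎_)
open import Relation.Nullary using (¬_; ⌊_⌋)
open import Relation.Binary.PropositionalEquality using (_≡_; _≢_)
open import Relation.Binary.Definitions using (DecidableEquality)
open import Function.Bundles using (_⇔_)

-- Vertices are the elements of the list 'verts' of a carrier type V;
-- 'adj' is the (Boolean) adjacency relation; 'ψ' labels vertices with
-- labels in L (only the labels of leaves are ever used).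
record Graph (L : Set) : Set₁ where
  field
    V     : Set
    _≟V_  : DecidableEquality V
    verts : List V
    adj   : V → V → Bool
    ψ     : V → L

module _ {L : Set} (G : Graph L) where
  open Graph G

  deg : V → ℕ
  deg x = sum (map (λ y → if adj x y then 1 else 0) verts)

  Edge : V → V → Set
  Edge x y = adj x y ≡ true

  Leaf : V → Set
  Leaf x = (x ∈ verts) × deg x ≡ 1

  EdgeWithout : V → V → V → V → Set
  EdgeWithout u v a b = Edge a b × ¬ ((a ≡ u × b ≡ v) ⊎ (a ≡ v × b ≡ u))

data Reach {V : Set} (R : V → V → Set) : V → V → Set where
  here  : ∀ {x} → Reach R x x
  there : ∀ {x y z} → R x y → Reach R y z → Reach R x z

data Walk {V : Set} (R : V → V → Set) : V → V → List V → Set where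
  stop : ∀ {a} → Walk R a a (a ∷ [])
  step : ∀ {a b c p} → R a b → Walk R b c p → Walk R a c (a ∷ p)

module _ {L : Set} (G : Graph L) where
  open Graph G

  -- A MUL-tree: connected, every edge is a bridge (acyclic), simple
  -- undirected graph, all non-leaf vertices have degree ≥ 3.
  record IsMULTree : Set where
    field
      complete  : ∀ x → x ∈ verts
      unique    : Unique verts
      symmetric : ∀ x y → adj x y ≡ adj y x
      irrefl    : ∀ x → adj x x ≡ false
      connected : ∀ x y → Reach (Edge G) x y
      acyclic   : ∀ x y → Edge G x y → ¬ Reach (EdgeWithout G x y) x y
      internal  : ∀ x → deg G x ≢ 1 → 3 ≤ deg G x

  Side : V → V → V → Set
  Side u v w = Reach (EdgeWithout G u v) u w

  InM : V → V → L → Set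
  InM u v m = (∃ λ w → Leaf G w × Side u v w × ψ w ≡ m)
            × ¬ (∃ λ w → Leaf G w × Side v u w × ψ w ≡ m)

  InΔ : V → V → L → L → L → L → Set
  InΔ u v a b c d = Edge G u v × InM u v a × InM u v b × InM v u c × InM v u d

  InI : L → L → L → L → Set
  InI a b c d = a ≢ b × a ≢ c × a ≢ d × b ≢ c × b ≢ d × c ≢ d
              × ∃ λ u → ∃ λ v → InΔ u v a b c d

  -- x lies on the (simple) path between two leaves labelled ℓ, i.e.
  -- x is a vertex of the minimal subtree spanning the ℓ-leaves
  InSpan : L → V → Set
  InSpan ℓ x = ∃ λ a → ∃ λ b → ∃ λ p →
      Leaf G a × ψ a ≡ ℓ × Leaf G b × ψ b ≡ ℓ
    × Walk (Edge G) a b p × Unique p × x ∈ p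

  SpanDeg≥3 : L → V → Set
  SpanDeg≥3 ℓ x = ∃ λ y₁ → ∃ λ y₂ → ∃ λ y₃ →
      y₁ ≢ y₂ × y₁ ≢ y₃ × y₂ ≢ y₃
    × Edge G x y₁ × Edge G x y₂ × Edge G x y₃
    × InSpan ℓ x × InSpan ℓ y₁ × InSpan ℓ y₂ × InSpan ℓ y₃

  _==_ : V → V → Bool
  x == y = ⌊ x ≟V y ⌋

  -- Prune(v): delete v; if its neighbour u then has degree two, delete u
  -- and join u's two remaining neighbours by an edge.
  pruneWith : V → V → Graph L
  pruneWith v u = record
    { V = V ; _≟V_ = _≟V_ ; verts = filterᵇ keep verts ; adj = adj' ; ψ = ψ }
    where
      removeU : Bool
      removeU = ⌊ deg G u ℕ≟ 3 ⌋
      keep : V → Bool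
      keep x = not (x == v) ∧ not (removeU ∧ (x == u))
      bypass : V → V → Bool
      bypass x y = removeU ∧ adj u x ∧ adj u y
                   ∧ not (x == v) ∧ not (y == v) ∧ not (x == y)
      adj' : V → V → Bool
      adj' x y = keep x ∧ keep y ∧ (adj x y ∨ bypass x y)

  prune : V → Graph L
  prune v with filterᵇ (adj v) verts
  ... | []    = record { V = V ; _≟V_ = _≟V_ ; verts = filterᵇ (λ x → not (x == v)) verts
                       ; adj = λ x y → not (x == v) ∧ not (y == v) ∧ adj x y ; ψ = ψ }
  ... | u ∷ _ = pruneWith v u

  Pendant : V → Set
  Pendant u = (u ∈ verts) × ¬ Leaf G u × ∃ λ w → Leaf G w × Edge G u w

SameInfo : {L : Set} → Graph L → Graph L → Set
SameInfo G H = ∀ a b c d → InI G a b c d ⇔ InI H a b c d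

Prunable : {L : Set} (G : Graph L) → Graph.V G → Set
Prunable G v = Leaf G v × SameInfo G (prune G v)

module Submission where

-- Every other edge of T survives (an edge at a suppressed u reappears as
-- the new edge) and splits the remaining leaves exactly as before, so the only label that can
-- disappear from a side is ℓ, on a side containing v.  Edges at v carry no quartet, since
-- the side of v holds the single label ℓ.  For any other edge, the side containing v contains u;
-- as u has degree at least three in the subtree spanning the ℓ-leaves, two neighbours p ≠ q of u
-- other than v lie in that subtree, the branches beyond p and beyond q each contain an ℓ-leaf, and
-- any side containing u contains one of these two leaves.

open import Data.Bool using (Bool; true; false; _∧_; _∨_; not; if_then_else_)
open import Data.Bool.Properties using (∧-identityʳ; ∧-zeroʳ; ∨-zeroʳ; not-¬; T-≡)
open import Data.Empty using (⊥; ⊥-elim)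
open import Data.List using (List; []; _∷_; _++_; filterᵇ; map)
open import Data.List.Membership.Propositional using (_∈_)
open import Data.List.Membership.Propositional.Properties using (∈-++⁺ʳ; ∈-++⁻; ∈-filter⁺; ∈-filter⁻)
open import Data.List.Relation.Unary.All.Properties using (All¬⇒¬Any)
open import Data.List.Relation.Unary.AllPairs using (_∷_)
open import Data.List.Relation.Unary.Any using (here; there)
open import Data.List.Relation.Unary.Unique.Propositional using (Unique)
open import Data.Nat using (ℕ; suc; _+_) renaming (_≟_ to _ℕ≟_)
open import Data.Nat.ListAction using (sum)
open import Data.Nat.Properties using (+-suc; suc-injective)
open import Data.Product using (∃; _×_; _,_; proj₁; proj₂)
import Data.Product as Product
open import Data.Sum using (_⊎_; inj₁; inj₂; [_,_])
import Data.Sum as Sum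
open import Function using (_∘_)
open import Function.Bundles using (Equivalence; mk⇔)
open import Relation.Binary.Definitions using (DecidableEquality)
open import Relation.Binary.PropositionalEquality using (_≡_; _≢_; refl; sym; trans; cong; subst; subst₂)
open import Relation.Nullary using (¬_; ⌊_⌋; yes; no; _×-dec_)
open import Relation.Nullary.Decidable using (T?)

open import Defs

∧-true⁻ : ∀ a {b} → a ∧ b ≡ true → a ≡ true × b ≡ true
∧-true⁻ true p = refl , p

∨-true : ∀ a {b} → a ∨ b ≡ true → a ≡ true ⊎ b ≡ true
∨-true true  _ = inj₁ refl
∨-true false p = inj₂ p

∧-true⁺ : ∀ {a b} → a ≡ true → b ≡ true → a ∧ b ≡ true
∧-true⁺ refl refl = refl

∨-trueˡ : ∀ {a b} → a ≡ true → a ∨ b ≡ true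
∨-trueˡ refl = refl

∨-trueʳ : ∀ a {b} → b ≡ true → a ∨ b ≡ true
∨-trueʳ a refl = ∨-zeroʳ a

true≢false : ∀ {a} → a ≡ true → a ≢ false
true≢false p = not-¬ p

module _ {V : Set} where

  infixr 5 _◅◅_
  infixl 5 _▻_

  _◅◅_ : ∀ {R : V → V → Set} {a b c} → Reach R a b → Reach R b c → Reach R a c
  here      ◅◅ q = q
  there s p ◅◅ q = there s (p ◅◅ q)

  _▻_ : ∀ {R : V → V → Set} {a b c} → Reach R a b → R b c → Reach R a c
  p ▻ s = p ◅◅ there s here

  reach-map : ∀ {R R′ : V → V → Set} → (∀ {x y} → R x y → R′ x y)
            → ∀ {a b} → Reach R a b → Reach R′ a b
  reach-map f here        = here
  reach-map f (there s p) = there (f s) (reach-map f p)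

  reach-gmap : ∀ {R R′ : V → V → Set} (f : V → V) → (∀ {x y} → R x y → Reach R′ (f x) (f y))
             → ∀ {a b} → Reach R a b → Reach R′ (f a) (f b)
  reach-gmap f g here        = here
  reach-gmap f g (there s p) = g s ◅◅ reach-gmap f g p

  reach-reverse : ∀ {R : V → V → Set} → (∀ {x y} → R x y → R y x)
                → ∀ {a b} → Reach R a b → Reach R b a
  reach-reverse sym-R here        = here
  reach-reverse sym-R (there s p) = reach-reverse sym-R p ▻ sym-R s

  walk-split : ∀ {R : V → V → Set} {a b xs s} → Walk R a b xs → s ∈ xs
             → ∃ λ ys → ∃ λ zs → xs ≡ ys ++ zs × Walk R a s (ys ++ s ∷ []) × Walk R s b zs
  walk-split stop       (here refl) = [] , _ , refl , stop , stop
  walk-split (step s w) (here refl) = [] , _ , refl , stop , step s w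
  walk-split {a = a} (step s w) (there m) with walk-split w m
  ... | ys , zs , refl , w₁ , w₂ = a ∷ ys , zs , refl , step s w₁ , w₂

  walk-head : ∀ {R : V → V → Set} {a b xs} → Walk R a b xs → a ∈ xs
  walk-head stop       = here refl
  walk-head (step _ _) = here refl

  unique-++-disjoint : ∀ {x : V} ys {zs} → Unique (ys ++ zs) → x ∈ ys → ¬ x ∈ zs
  unique-++-disjoint (y ∷ ys) (y∉ ∷ _) (here refl) m = All¬⇒¬Any y∉ (∈-++⁺ʳ ys m)
  unique-++-disjoint (y ∷ ys) (_ ∷ u)  (there m′)  m = unique-++-disjoint ys u m′ m

module WithDecidableEquality {V : Set} (_≟_ : DecidableEquality V) where

  ≢⇒≟-false : ∀ {x y} → x ≢ y → ⌊ x ≟ y ⌋ ≡ false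
  ≢⇒≟-false {x} {y} x≢y with x ≟ y
  ... | yes x≡y = ⊥-elim (x≢y x≡y)
  ... | no  _   = refl

  ≢⇒not-≟ : ∀ {x y} → x ≢ y → not ⌊ x ≟ y ⌋ ≡ true
  ≢⇒not-≟ x≢y = cong not (≢⇒≟-false x≢y)

  ≟-refl : ∀ {x} → ⌊ x ≟ x ⌋ ≡ true
  ≟-refl {x} with x ≟ x
  ... | yes _   = refl
  ... | no  x≢x = ⊥-elim (x≢x refl)

  not-≟⇒≢ : ∀ {x y} → not ⌊ x ≟ y ⌋ ≡ true → x ≢ y
  not-≟⇒≢ {x} p refl rewrite ≟-refl {x} = true≢false p refl

  module _ (u : V) {R R′ : V → V → Set}
           (restrict : ∀ {x y} → R x y → x ≢ u → y ≢ u → R′ x y) where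

    reach-visits-or-avoids : ∀ {a b} → Reach R a b → Reach R a u ⊎ Reach R′ a b
    reach-visits-or-avoids here = inj₂ here
    reach-visits-or-avoids (there {x = a} {y = a₁} s p) with a ≟ u | reach-visits-or-avoids p
    ... | yes refl | _       = inj₁ here
    ... | no  _    | inj₁ q  = inj₁ (there s q)
    ... | no  a≢u  | inj₂ q with a₁ ≟ u
    ...   | yes refl = inj₁ (there s here)
    ...   | no  a₁≢u = inj₂ (there (restrict s a≢u a₁≢u) q)

    walk-visits-or-avoids : ∀ {a b xs} → Walk R a b xs → u ∈ xs ⊎ Reach R′ a b
    walk-visits-or-avoids stop = inj₂ here
    walk-visits-or-avoids (step {a = a} {b = a₁} s w) with a ≟ u | walk-visits-or-avoids w
    ... | yes refl | _       = inj₁ (here refl)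
    ... | no  _    | inj₁ m  = inj₁ (there m)
    ... | no  a≢u  | inj₂ q with a₁ ≟ u
    ...   | yes refl = inj₁ (there (walk-head w))
    ...   | no  a₁≢u = inj₂ (there (restrict s a≢u a₁≢u) q)

  two-distinct-avoiding : ∀ {P : V → Set} v {a b c} → a ≢ b → a ≢ c → b ≢ c → P a → P b → P c
                        → ∃ λ s → ∃ λ t → s ≢ t × s ≢ v × t ≢ v × P s × P t
  two-distinct-avoiding v {a} {b} a≢b a≢c b≢c Pa Pb Pc with a ≟ v | b ≟ v
  ... | yes refl | _        = b , _ , b≢c , a≢b ∘ sym , a≢c ∘ sym , Pb , Pc
  ... | no  a≢v  | yes refl = a , _ , a≢c , a≢v , b≢c ∘ sym , Pa , Pc
  ... | no  a≢v  | no  b≢v  = a , b , a≢b , a≢v , b≢v , Pa , Pb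

  count : (V → Bool) → List V → ℕ
  count f xs = sum (map (λ y → if f y then 1 else 0) xs)

  without : (V → Bool) → V → V → Bool
  without f a y = f y ∧ not ⌊ y ≟ a ⌋

  without-true : ∀ f {a z} → f z ≡ true → z ≢ a → without f a z ≡ true
  without-true f fz z≢a = ∧-true⁺ fz (≢⇒not-≟ z≢a)

  count-filterᵇ : ∀ k f xs → count f (filterᵇ k xs) ≡ count (λ y → k y ∧ f y) xs
  count-filterᵇ k f [] = refl
  count-filterᵇ k f (x ∷ xs) with k x
  ... | true  = cong ((if f x then 1 else 0) +_) (count-filterᵇ k f xs)
  ... | false = count-filterᵇ k f xs

  count-cong : ∀ f g xs → (∀ y → y ∈ xs → f y ≡ g y) → count f xs ≡ count g xs
  count-cong f g [] _ = refl
  count-cong f g (x ∷ xs) f≗g rewrite f≗g x (here refl) =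
    cong ((if g x then 1 else 0) +_) (count-cong f g xs (λ y m → f≗g y (there m)))

  count-remove : ∀ f {a} xs → Unique xs → a ∈ xs → f a ≡ true
               → count f xs ≡ suc (count (without f a) xs)
  count-remove f (x ∷ xs) (x∉ ∷ _) (here refl) fx rewrite fx | ≟-refl {x} =
    cong suc (count-cong f (without f x) xs λ y y∈ →
      sym (trans (cong (λ b → f y ∧ not b) (≢⇒≟-false λ { refl → All¬⇒¬Any x∉ y∈ }))
                 (∧-identityʳ (f y))))
  count-remove f {a} (x ∷ xs) (x∉ ∷ u) (there a∈) fa
    rewrite ≢⇒≟-false {x} {a} (λ { refl → All¬⇒¬Any x∉ a∈ }) | ∧-identityʳ (f x)
          | count-remove f xs u a∈ fa = +-suc _ _

  count≡0⇒false : ∀ f xs → count f xs ≡ 0 → ∀ {y} → y ∈ xs → f y ≡ false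
  count≡0⇒false f (x ∷ xs) c (here refl) with f x
  ... | false = refl
  count≡0⇒false f (x ∷ xs) c (there y∈) with f x
  ... | false = count≡0⇒false f xs c y∈

  false⇒count≡0 : ∀ f xs → (∀ {y} → y ∈ xs → f y ≡ false) → count f xs ≡ 0
  false⇒count≡0 f [] _ = refl
  false⇒count≡0 f (x ∷ xs) none rewrite none (here refl) = false⇒count≡0 f xs (none ∘ there)

  count≡suc⇒witness : ∀ f xs {n} → count f xs ≡ suc n → ∃ λ y → y ∈ xs × f y ≡ true
  count≡suc⇒witness f (x ∷ xs) c with f x in fx
  ... | true  = x , here refl , fx
  ... | false with count≡suc⇒witness f xs c
  ...   | y , y∈ , fy = y , there y∈ , fy

  module _ {xs : List V} (xs! : Unique xs) where

    count-without : ∀ g {a n} → a ∈ xs → g a ≡ true → count g xs ≡ suc n → count (without g a) xs ≡ n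
    count-without g a∈ ga c = suc-injective (trans (sym (count-remove g xs xs! a∈ ga)) c)

    count≡1⇒unique : ∀ f → count f xs ≡ 1
                   → ∃ λ y → y ∈ xs × f y ≡ true × ∀ {z} → z ∈ xs → f z ≡ true → z ≡ y
    count≡1⇒unique f c with count≡suc⇒witness f xs c
    ... | y , y∈ , fy = y , y∈ , fy , only-y
      where
      rest≡0 : count (without f y) xs ≡ 0
      rest≡0 = count-without f y∈ fy c
      only-y : ∀ {z} → z ∈ xs → f z ≡ true → z ≡ y
      only-y {z} z∈ fz with z ≟ y
      ... | yes z≡y = z≡y
      ... | no  z≢y = ⊥-elim (true≢false (without-true f fz z≢y) (count≡0⇒false _ xs rest≡0 z∈))

    unique⇒count≡1 : ∀ f {y} → y ∈ xs → f y ≡ true → (∀ {z} → z ∈ xs → f z ≡ true → z ≡ y)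
                   → count f xs ≡ 1
    unique⇒count≡1 f {y} y∈ fy only-y =
      trans (count-remove f xs xs! y∈ fy) (cong suc (false⇒count≡0 _ xs rest-false))
      where
      rest-false : ∀ {z} → z ∈ xs → without f y z ≡ false
      rest-false {z} z∈ with f z in fz
      ... | false = refl
      ... | true rewrite only-y z∈ fz | ≟-refl {y} = refl

    count≡3⇒one-of : ∀ f → count f xs ≡ 3 → ∀ {a b c} → a ≢ b → a ≢ c → b ≢ c
                   → a ∈ xs → b ∈ xs → c ∈ xs → f a ≡ true → f b ≡ true → f c ≡ true
                   → ∀ {z} → z ∈ xs → f z ≡ true → z ≡ a ⊎ z ≡ b ⊎ z ≡ c
    count≡3⇒one-of f c₃ {a} {b} {c} a≢b a≢c b≢c a∈ b∈ c∈ fa fb fc {z} z∈ fz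
      with z ≟ a | z ≟ b | z ≟ c
    ... | yes z≡a | _       | _       = inj₁ z≡a
    ... | no  _   | yes z≡b | _       = inj₂ (inj₁ z≡b)
    ... | no  _   | no  _   | yes z≡c = inj₂ (inj₂ z≡c)
    ... | no  z≢a | no  z≢b | no  z≢c =
      ⊥-elim (true≢false (without-true f″ (without-true f′ (without-true f fz z≢a) z≢b) z≢c)
                         (count≡0⇒false f‴ xs rest≡0 z∈))
      where
      f′ f″ f‴ : V → Bool
      f′ = without f a
      f″ = without f′ b
      f‴ = without f″ c
      rest≡0 : count f‴ xs ≡ 0
      rest≡0 = count-without f″ c∈ (without-true f′ (without-true f fc (a≢c ∘ sym)) (b≢c ∘ sym))
                 (count-without f′ b∈ (without-true f fb (a≢b ∘ sym))
                   (count-without f a∈ fa c₃))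

module _ {L : Set} (G : Graph L) where

  without-flip : ∀ {x y a b} → EdgeWithout G x y a b → EdgeWithout G y x a b
  without-flip (e , ¬xy) = e , λ where
    (inj₁ p) → ¬xy (inj₂ p)
    (inj₂ p) → ¬xy (inj₁ p)

  without-sym : (∀ {a b} → Edge G a b → Edge G b a)
              → ∀ {x y a b} → EdgeWithout G x y a b → EdgeWithout G x y b a
  without-sym edge-sym (e , ¬xy) = edge-sym e , λ where
    (inj₁ (a≡x , b≡y)) → ¬xy (inj₂ (b≡y , a≡x))
    (inj₂ (a≡y , b≡x)) → ¬xy (inj₁ (b≡x , a≡y))

LabelOnSide : {L : Set} (G : Graph L) → Graph.V G → Graph.V G → L → Set
LabelOnSide G x y m = ∃ λ w → Leaf G w × Side G x y w × Graph.ψ G w ≡ m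

module MULTree {L : Set} (T : Graph L) (isT : IsMULTree T) where
  open Graph T
  open IsMULTree isT
  open WithDecidableEquality _≟V_

  private
    E : V → V → Set
    E = Edge T
    W : V → V → V → V → Set
    W = EdgeWithout T

  edge-sym : ∀ {x y} → E x y → E y x
  edge-sym {x} {y} e = trans (symmetric y x) e

  edge⇒≢ : ∀ {x y} → E x y → x ≢ y
  edge⇒≢ {x} e refl = true≢false e (irrefl x)

  without? : ∀ x y {a b} → E a b → W x y a b ⊎ (a ≡ x × b ≡ y) ⊎ (a ≡ y × b ≡ x)
  without? x y {a} {b} e with (a ≟V x) ×-dec (b ≟V y) | (a ≟V y) ×-dec (b ≟V x)
  ... | yes p  | _      = inj₂ (inj₁ p)
  ... | no  _  | yes p  = inj₂ (inj₂ p)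
  ... | no ¬p  | no ¬q  = inj₁ (e , [ ¬p , ¬q ])

  avoiding⇒without : ∀ {u a b} t → E a b → a ≢ u → b ≢ u → W u t a b
  avoiding⇒without t e a≢u b≢u = e , [ a≢u ∘ proj₁ , b≢u ∘ proj₂ ]

  flip-side : ∀ {x y a b} → Reach (W x y) a b → Reach (W y x) a b
  flip-side = reach-map (without-flip T)

  reverse-side : ∀ {x y a b} → Reach (W x y) a b → Reach (W x y) b a
  reverse-side = reach-reverse (without-sym T edge-sym)

  reach-split : ∀ x y {a z} → Reach E a z
              → Reach (W x y) a z ⊎ Reach (W x y) y z ⊎ Reach (W x y) x z
  reach-split x y here = inj₁ here
  reach-split x y (there s p) with reach-split x y p
  ... | inj₂ q = inj₂ q
  ... | inj₁ q with without? x y s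
  ...   | inj₁ s′                   = inj₁ (there s′ q)
  ...   | inj₂ (inj₁ (refl , refl)) = inj₂ (inj₁ q)
  ...   | inj₂ (inj₂ (refl , refl)) = inj₂ (inj₂ q)

  side-total : ∀ {x y} → E x y → ∀ z → Side T x y z ⊎ Side T y x z
  side-total {x} {y} e z with reach-split x y (connected x z)
  ... | inj₁ q        = inj₁ q
  ... | inj₂ (inj₁ q) = inj₂ (flip-side q)
  ... | inj₂ (inj₂ q) = inj₁ q

  sides-disjoint : ∀ {x y z} → E x y → Side T x y z → Side T y x z → ⊥
  sides-disjoint {x} {y} e sx sy = acyclic x y e (sx ◅◅ reverse-side (flip-side sy))

  side-avoids-root : ∀ {u s w} t → E s u → Side T s u w → Reach (W u t) s w
  side-avoids-root {u} {s} t e side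
    with reach-visits-or-avoids u (λ st → avoiding⇒without t (proj₁ st)) side
  ... | inj₁ to-u = ⊥-elim (acyclic s u e to-u)
  ... | inj₂ r    = r

  no-triangle : ∀ {u a b} → E u a → E u b → a ≢ b → ¬ E a b
  no-triangle {u} {a} {b} ea eb a≢b eab = acyclic a b eab
    (there (edge-sym ea , [ edge⇒≢ eb ∘ proj₂ , a≢b ∘ proj₁ ])
    (there (eb , [ edge⇒≢ ea ∘ proj₁ , edge⇒≢ eb ∘ proj₁ ]) here))

  leaf-neighbour : ∀ {w} → Leaf T w → ∃ λ n → E w n × ∀ {y} → E w y → y ≡ n
  leaf-neighbour {w} (_ , deg≡1) with count≡1⇒unique unique (adj w) deg≡1
  ... | n , _ , e , only-n = n , e , λ e′ → only-n (complete _) e′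

  leaf-neighbours-equal : ∀ {w a b} → Leaf T w → E w a → E w b → a ≡ b
  leaf-neighbours-equal l ea eb with leaf-neighbour l
  ... | _ , _ , only-n = trans (only-n ea) (sym (only-n eb))

  unique-neighbour⇒leaf : ∀ {w n} → E w n → (∀ {y} → E w y → y ≡ n) → Leaf T w
  unique-neighbour⇒leaf e only-n = complete _ , unique⇒count≡1 unique _ (complete _) e (λ _ → only-n)

  leaf-side : ∀ {w y z} → Leaf T w → E w y → Side T w y z → z ≡ w
  leaf-side l e here = refl
  leaf-side l e (there (e′ , ¬wy) p) with leaf-neighbours-equal l e e′
  ... | refl = ⊥-elim (¬wy (inj₁ (refl , refl)))

  deg≡3⇒one-of : ∀ {u a b c} → deg T u ≡ 3 → a ≢ b → a ≢ c → b ≢ c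
               → E u a → E u b → E u c → ∀ {z} → E u z → z ≡ a ⊎ z ≡ b ⊎ z ≡ c
  deg≡3⇒one-of d a≢b a≢c b≢c ea eb ec ez =
    count≡3⇒one-of unique _ d a≢b a≢c b≢c (complete _) (complete _) (complete _) ea eb ec (complete _) ez

  beyond-neighbour≢ : ∀ {u p v w} → E u p → E u v → p ≢ v → Side T p u w → w ≢ v
  beyond-neighbour≢ up uv p≢v p-w refl =
    sides-disjoint (edge-sym up) p-w (there (uv , [ p≢v ∘ sym ∘ proj₂ , edge⇒≢ up ∘ proj₁ ]) here)

  prune-leaf : ∀ {u v} → Leaf T v → E u v → prune T v ≡ pruneWith T v u
  prune-leaf {u} {v} leaf-v uv with filterᵇ (adj v) verts in eq
  ... | [] with subst (u ∈_) eq (∈-filter⁺ (T? ∘ adj v) (complete u) (Equivalence.from T-≡ (edge-sym uv)))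
  ...   | ()
  prune-leaf {u} {v} leaf-v uv | u′ ∷ _ =
    cong (pruneWith T v) (leaf-neighbours-equal leaf-v vu′ (edge-sym uv))
    where
    vu′ : E v u′
    vu′ = Equivalence.to T-≡ (proj₂ (∈-filter⁻ (T? ∘ adj v) {xs = verts} (subst (u′ ∈_) (sym eq) (here refl))))

  -- If both ends of the path lay on u's side, the path would visit u both before and after s.
  span-branch-leaf : ∀ {ℓ u s} → E u s → InSpan T ℓ s → ∃ λ w → Leaf T w × ψ w ≡ ℓ × Side T s u w
  span-branch-leaf {ℓ} {u} {s} es (a , b , xs , la , ψa , lb , ψb , walk , xs! , s∈)
    with side-total (edge-sym es) a | side-total (edge-sym es) b
  ... | inj₁ sa | _      = a , la , ψa , sa
  ... | inj₂ _  | inj₁ sb = b , lb , ψb , sb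
  ... | inj₂ ua | inj₂ ub with walk-split walk s∈
  ... | ys , zs , refl , to-s , from-s
    with walk-visits-or-avoids u (avoiding⇒without s) to-s
       | walk-visits-or-avoids u (avoiding⇒without s) from-s
  ... | inj₂ a⇝s | _        = ⊥-elim (acyclic u s es (ua ◅◅ a⇝s))
  ... | inj₁ _   | inj₂ s⇝b = ⊥-elim (acyclic u s es (reverse-side (s⇝b ◅◅ reverse-side ub)))
  ... | inj₁ u∈  | inj₁ u∈zs with ∈-++⁻ ys u∈
  ...   | inj₁ u∈ys        = ⊥-elim (unique-++-disjoint ys xs! u∈ys u∈zs)
  ...   | inj₂ (here u≡s)  = ⊥-elim (edge⇒≢ es u≡s)

  -- Leaves beyond two distinct neighbours of u are joined only through u.
  branch-leaves-meet-side : ∀ {u p q wp wq x y} → E u p → E u q → p ≢ q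
                          → Side T p u wp → Side T q u wq
                          → E x y → Side T x y u → Side T x y wp ⊎ Side T x y wq
  branch-leaves-meet-side {u} {p} {q} {wp} {wq} {x} {y} ep eq p≢q p-wp q-wq exy x-u
    with side-total exy wp | side-total exy wq
  ... | inj₁ x-wp | _       = inj₁ x-wp
  ... | inj₂ _    | inj₁ x-wq = inj₂ x-wq
  ... | inj₂ y-wp | inj₂ y-wq
    with reach-visits-or-avoids u (λ st → avoiding⇒without p (proj₁ st))
           (reverse-side (flip-side y-wp) ◅◅ flip-side y-wq)
  ... | inj₁ wp⇝u  = ⊥-elim (sides-disjoint exy x-u (flip-side (flip-side y-wp ◅◅ wp⇝u)))
  ... | inj₂ wp⇝wq = ⊥-elim (acyclic u p ep
          (there (eq , [ p≢q ∘ sym ∘ proj₂ , edge⇒≢ ep ∘ proj₁ ])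
            (side-avoids-root p (edge-sym eq) q-wq
             ◅◅ reverse-side wp⇝wq ◅◅ reverse-side (flip-side p-wp))))

  label-recurs : ∀ {ℓ u v p q} → E u v → E u p → E u q → p ≢ q → p ≢ v → q ≢ v
               → InSpan T ℓ p → InSpan T ℓ q → ψ v ≡ ℓ
               → ∀ {x y} → E x y → x ≢ v → y ≢ v → Side T x y v
               → ∃ λ w → Leaf T w × w ≢ v × Side T x y w × ψ w ≡ ψ v
  label-recurs uv up uq p≢q p≢v q≢v span-p span-q ψv≡ℓ exy x≢v y≢v x-v
    with span-branch-leaf up span-p | span-branch-leaf uq span-q
  ... | wp , leaf-wp , ψwp , p-wp | wq , leaf-wq , ψwq , q-wq
    with branch-leaves-meet-side up uq p≢q p-wp q-wq exy
           (x-v ▻ (edge-sym uv , [ x≢v ∘ sym ∘ proj₁ , y≢v ∘ sym ∘ proj₁ ]))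
  ... | inj₁ x-wp = wp , leaf-wp , beyond-neighbour≢ up uv p≢v p-wp , x-wp , trans ψwp (sym ψv≡ℓ)
  ... | inj₂ x-wq = wq , leaf-wq , beyond-neighbour≢ uq uv q≢v q-wq , x-wq , trans ψwq (sym ψv≡ℓ)

module Pruning {L : Set} (T : Graph L) (isT : IsMULTree T)
               {v u p q : Graph.V T} (leaf-v : Leaf T v) (uv : Edge T u v)
               (up : Edge T u p) (uq : Edge T u q) (p≢q : p ≢ q) (p≢v : p ≢ v) (q≢v : q ≢ v) where
  open Graph T
  open IsMULTree isT
  open WithDecidableEquality _≟V_
  open MULTree T isT

  P : Graph L
  P = pruneWith T v u

  private
    E E′ : V → V → Set
    E  = Edge T
    E′ = Edge P
    W W′ : V → V → V → V → Set
    W  = EdgeWithout T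
    W′ = EdgeWithout P

  removesU : Bool
  removesU = ⌊ deg T u ℕ≟ 3 ⌋

  removesU⇒deg≡3 : removesU ≡ true → deg T u ≡ 3
  removesU⇒deg≡3 r with deg T u ℕ≟ 3
  ... | yes d = d

  v-neighbour : ∀ {z} → E v z → z ≡ u
  v-neighbour e = leaf-neighbours-equal leaf-v e (edge-sym uv)

  u-neighbour : removesU ≡ true → ∀ {z} → E u z → z ≡ v ⊎ z ≡ p ⊎ z ≡ q
  u-neighbour r = deg≡3⇒one-of (removesU⇒deg≡3 r) (p≢v ∘ sym) (q≢v ∘ sym) p≢q uv up uq

  kept? : V → Bool
  kept? x = not ⌊ x ≟V v ⌋ ∧ not (removesU ∧ ⌊ x ≟V u ⌋)

  bypass? : V → V → Bool
  bypass? x y = removesU ∧ adj u x ∧ adj u y ∧ not ⌊ x ≟V v ⌋ ∧ not ⌊ y ≟V v ⌋ ∧ not ⌊ x ≟V y ⌋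

  pruned-deg : ∀ w → deg P w ≡ count (Graph.adj P w) verts
  pruned-deg w = trans (count-filterᵇ kept? (Graph.adj P w) verts) (count-cong _ _ verts λ y _ → lemma y)
    where
    lemma : ∀ y → kept? y ∧ Graph.adj P w y ≡ Graph.adj P w y
    lemma y with kept? y
    ... | true  = refl
    ... | false = sym (∧-zeroʳ (kept? w))

  Kept : V → Set
  Kept x = x ≢ v × (removesU ≡ true → x ≢ u)

  Removed : V → Set
  Removed x = x ≡ v ⊎ (removesU ≡ true × x ≡ u)

  kept-or-removed : ∀ x → Kept x ⊎ Removed x
  kept-or-removed x with x ≟V v | x ≟V u
  ... | yes x≡v | _       = inj₂ (inj₁ x≡v)
  ... | no  x≢v | no  x≢u = inj₁ (x≢v , λ _ → x≢u)
  ... | no  x≢v | yes x≡u with removesU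
  ...   | true  = inj₂ (inj₂ (refl , x≡u))
  ...   | false = inj₁ (x≢v , λ ())

  kept-not-removed : ∀ {z} → Kept z → ¬ Removed z
  kept-not-removed (z≢v , _)   (inj₁ z≡v)       = z≢v z≡v
  kept-not-removed (_ , z≢u)   (inj₂ (r , z≡u)) = z≢u r z≡u

  Kept⇒kept? : ∀ {x} → Kept x → kept? x ≡ true
  Kept⇒kept? {x} (x≢v , x≢u) with removesU
  ... | false rewrite ≢⇒≟-false x≢v = refl
  ... | true  rewrite ≢⇒≟-false x≢v | ≢⇒≟-false (x≢u refl) = refl

  kept?⇒Kept : ∀ {x} → kept? x ≡ true → Kept x
  kept?⇒Kept {x} k with kept-or-removed x
  ... | inj₁ kx                   = kx
  ... | inj₂ (inj₁ refl)          rewrite ≟-refl {x} = ⊥-elim (true≢false k refl)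
  ... | inj₂ (inj₂ (r , refl)) rewrite r | ≟-refl {x} | ∧-zeroʳ (not ⌊ x ≟V v ⌋) = ⊥-elim (true≢false k refl)

  neighbour-kept : ∀ {z} → E u z → z ≢ v → Kept z
  neighbour-kept e z≢v = z≢v , λ _ z≡u → edge⇒≢ e (sym z≡u)

  u-not-leaf : ¬ Leaf T u
  u-not-leaf l = p≢q (leaf-neighbours-equal l up uq)

  leaf-kept : ∀ {w} → Leaf T w → w ≢ v → Kept w
  leaf-kept l w≢v = w≢v , λ { _ refl → u-not-leaf l }

  PQ : V → V → Set
  PQ s s′ = (s ≡ p × s′ ≡ q) ⊎ (s ≡ q × s′ ≡ p)

  pq-sym : ∀ {s s′} → PQ s s′ → PQ s′ s
  pq-sym (inj₁ (refl , refl)) = inj₂ (refl , refl)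
  pq-sym (inj₂ (refl , refl)) = inj₁ (refl , refl)

  pq-edge : ∀ {s s′} → PQ s s′ → E u s
  pq-edge (inj₁ (refl , _)) = up
  pq-edge (inj₂ (refl , _)) = uq

  pq-≢ : ∀ {s s′} → PQ s s′ → s ≢ s′
  pq-≢ (inj₁ (refl , refl)) = p≢q
  pq-≢ (inj₂ (refl , refl)) = p≢q ∘ sym

  pq-≢v : ∀ {s s′} → PQ s s′ → s ≢ v
  pq-≢v (inj₁ (refl , _)) = p≢v
  pq-≢v (inj₂ (refl , _)) = q≢v

  pq-kept : ∀ {s s′} → PQ s s′ → Kept s
  pq-kept pq = neighbour-kept (pq-edge pq) (pq-≢v pq)

  pq-partner-unique : ∀ {s a b} → PQ s a → PQ s b → a ≡ b
  pq-partner-unique (inj₁ (refl , refl)) (inj₁ (_ , refl))    = refl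
  pq-partner-unique (inj₁ (refl , refl)) (inj₂ (p≡q , _))     = ⊥-elim (p≢q p≡q)
  pq-partner-unique (inj₂ (refl , refl)) (inj₁ (q≡p , _))     = ⊥-elim (p≢q (sym q≡p))
  pq-partner-unique (inj₂ (refl , refl)) (inj₂ (_ , refl))    = refl

  pq-same-pair : ∀ {s s′ a b} → PQ s s′ → PQ a b → (a ≡ s × b ≡ s′) ⊎ (a ≡ s′ × b ≡ s)
  pq-same-pair (inj₁ (refl , refl)) (inj₁ ab) = inj₁ ab
  pq-same-pair (inj₁ (refl , refl)) (inj₂ ab) = inj₂ ab
  pq-same-pair (inj₂ (refl , refl)) (inj₁ ab) = inj₂ ab
  pq-same-pair (inj₂ (refl , refl)) (inj₂ ab) = inj₁ ab

  pq-no-edge : ∀ {s s′} → PQ s s′ → ¬ E s s′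
  pq-no-edge pq = no-triangle (pq-edge pq) (pq-edge (pq-sym pq)) (pq-≢ pq)

  partner : removesU ≡ true → ∀ {s} → E u s → s ≢ v → ∃ λ s′ → PQ s s′
  partner r e s≢v with u-neighbour r e
  ... | inj₁ s≡v           = ⊥-elim (s≢v s≡v)
  ... | inj₂ (inj₁ refl)   = q , inj₁ (refl , refl)
  ... | inj₂ (inj₂ refl)   = p , inj₂ (refl , refl)

  Bypass : V → V → Set
  Bypass x y = removesU ≡ true × PQ x y

  bypass-from-neighbours : removesU ≡ true → ∀ {x y} → E u x → E u y → x ≢ v → y ≢ v → x ≢ y → PQ x y
  bypass-from-neighbours r ex ey x≢v y≢v x≢y with u-neighbour r ex | u-neighbour r ey
  ... | inj₁ x≡v         | _                = ⊥-elim (x≢v x≡v)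
  ... | _                | inj₁ y≡v         = ⊥-elim (y≢v y≡v)
  ... | inj₂ (inj₁ refl) | inj₂ (inj₁ refl) = ⊥-elim (x≢y refl)
  ... | inj₂ (inj₁ refl) | inj₂ (inj₂ refl) = inj₁ (refl , refl)
  ... | inj₂ (inj₂ refl) | inj₂ (inj₁ refl) = inj₂ (refl , refl)
  ... | inj₂ (inj₂ refl) | inj₂ (inj₂ refl) = ⊥-elim (x≢y refl)

  bypass?⇒Bypass : ∀ {x y} → bypass? x y ≡ true → Bypass x y
  bypass?⇒Bypass {x} {y} b =
    let r   , b₁  = ∧-true⁻ removesU b
        ux  , b₂  = ∧-true⁻ (adj u x) b₁
        uy  , b₃  = ∧-true⁻ (adj u y) b₂
        x≠v , b₄  = ∧-true⁻ (not ⌊ x ≟V v ⌋) b₃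
        y≠v , x≠y = ∧-true⁻ (not ⌊ y ≟V v ⌋) b₄
    in r , bypass-from-neighbours r ux uy (not-≟⇒≢ x≠v) (not-≟⇒≢ y≠v) (not-≟⇒≢ x≠y)

  Bypass⇒bypass? : ∀ {x y} → Bypass x y → bypass? x y ≡ true
  Bypass⇒bypass? (r , pq) =
    ∧-true⁺ r (∧-true⁺ (pq-edge pq) (∧-true⁺ (pq-edge (pq-sym pq))
      (∧-true⁺ (≢⇒not-≟ (pq-≢v pq)) (∧-true⁺ (≢⇒not-≟ (pq-≢v (pq-sym pq))) (≢⇒not-≟ (pq-≢ pq))))))

  pruned-edge⁻ : ∀ {x y} → E′ x y → Kept x × Kept y × (E x y ⊎ Bypass x y)
  pruned-edge⁻ {x} {y} e =
    let kx , e₁ = ∧-true⁻ (kept? x) e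
        ky , e₂ = ∧-true⁻ (kept? y) e₁
    in kept?⇒Kept kx , kept?⇒Kept ky , Sum.map₂ bypass?⇒Bypass (∨-true (adj x y) e₂)

  pruned-edge⁺ : ∀ {x y} → Kept x → Kept y → E x y ⊎ Bypass x y → E′ x y
  pruned-edge⁺ kx ky (inj₁ e) =
    ∧-true⁺ (Kept⇒kept? kx) (∧-true⁺ (Kept⇒kept? ky) (∨-trueˡ e))
  pruned-edge⁺ {x} kx ky (inj₂ b) =
    ∧-true⁺ (Kept⇒kept? kx) (∧-true⁺ (Kept⇒kept? ky) (∨-trueʳ (adj x _) (Bypass⇒bypass? b)))

  pruned-edge-sym : ∀ {x y} → E′ x y → E′ y x
  pruned-edge-sym e with pruned-edge⁻ e
  ... | kx , ky , inj₁ exy       = pruned-edge⁺ ky kx (inj₁ (edge-sym exy))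
  ... | kx , ky , inj₂ (r , pq) = pruned-edge⁺ ky kx (inj₂ (r , pq-sym pq))

  pruned-vertex⁻ : ∀ {w} → w ∈ Graph.verts P → Kept w
  pruned-vertex⁻ w∈ = kept?⇒Kept (Equivalence.to T-≡ (proj₂ (∈-filter⁻ (T? ∘ kept?) {xs = verts} w∈)))

  pruned-vertex⁺ : ∀ {w} → Kept w → w ∈ Graph.verts P
  pruned-vertex⁺ kw = ∈-filter⁺ (T? ∘ kept?) (complete _) (Equivalence.from T-≡ (Kept⇒kept? kw))

  pruned-leaf⁻ : ∀ {w} → Leaf P w → Kept w × ∃ λ m → E′ w m × ∀ {y} → E′ w y → y ≡ m
  pruned-leaf⁻ {w} (w∈ , deg≡1) with count≡1⇒unique unique (Graph.adj P w) (trans (sym (pruned-deg w)) deg≡1)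
  ... | m , _ , e , only-m = pruned-vertex⁻ w∈ , m , e , λ e′ → only-m (complete _) e′

  pruned-leaf⁺ : ∀ {w m} → Kept w → E′ w m → (∀ {y} → E′ w y → y ≡ m) → Leaf P w
  pruned-leaf⁺ {w} kw e only-m =
    pruned-vertex⁺ kw , trans (pruned-deg w) (unique⇒count≡1 unique _ (complete _) e (λ _ → only-m))

  pruned-leaf⇒leaf : ∀ {w} → Leaf P w → Leaf T w × w ≢ v
  pruned-leaf⇒leaf {w} l with pruned-leaf⁻ l
  ... | kw@(w≢v , _) , m , wm , only-m = leaf (proj₂ (proj₂ (pruned-edge⁻ wm))) , w≢v
    where
    w≢u : w ≢ u
    w≢u refl = p≢q (trans (only-m (pruned-edge⁺ kw (neighbour-kept up p≢v) (inj₁ up)))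
                     (sym (only-m (pruned-edge⁺ kw (neighbour-kept uq q≢v) (inj₁ uq)))))

    not-next-to-v : ∀ {y} → E w y → y ≢ v
    not-next-to-v e refl = w≢u (v-neighbour (edge-sym e))

    leaf : E w m ⊎ Bypass w m → Leaf T w
    leaf (inj₁ e) = unique-neighbour⇒leaf e only
      where
      only : ∀ {y} → E w y → y ≡ m
      only {y} e′ with kept-or-removed y
      ... | inj₁ ky               = only-m (pruned-edge⁺ kw ky (inj₁ e′))
      ... | inj₂ (inj₁ y≡v)       = ⊥-elim (not-next-to-v e′ y≡v)
      ... | inj₂ (inj₂ (r , refl)) with partner r (edge-sym e′) w≢v
      ...   | _ , pq = ⊥-elim (pq-no-edge pq
                (subst (E w) (sym (only-m (pruned-edge⁺ kw (pq-kept (pq-sym pq)) (inj₂ (r , pq))))) e))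
    leaf (inj₂ (_ , pq)) = unique-neighbour⇒leaf (edge-sym (pq-edge pq)) only
      where
      only : ∀ {y} → E w y → y ≡ u
      only {y} e′ with kept-or-removed y
      ... | inj₁ ky               = ⊥-elim (pq-no-edge pq (subst (E w) (only-m (pruned-edge⁺ kw ky (inj₁ e′))) e′))
      ... | inj₂ (inj₁ y≡v)       = ⊥-elim (not-next-to-v e′ y≡v)
      ... | inj₂ (inj₂ (_ , y≡u)) = y≡u

  leaf⇒pruned-leaf : ∀ {w} → Leaf T w → w ≢ v → Leaf P w
  leaf⇒pruned-leaf {w} l w≢v with leaf-neighbour l
  ... | n , wn , only-n with kept-or-removed n
  ... | inj₁ kn = pruned-leaf⁺ kw (pruned-edge⁺ kw kn (inj₁ wn)) only
    where
    kw : Kept w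
    kw = leaf-kept l w≢v
    only : ∀ {y} → E′ w y → y ≡ n
    only e′ with pruned-edge⁻ e′
    ... | _ , _ , inj₁ e        = only-n e
    ... | _ , _ , inj₂ (r , pq) = ⊥-elim (proj₂ kn r (sym (only-n (edge-sym (pq-edge pq)))))
  ... | inj₂ (inj₁ refl) = ⊥-elim (u-not-leaf (subst (Leaf T) (v-neighbour (edge-sym wn)) l))
  ... | inj₂ (inj₂ (r , refl)) with partner r (edge-sym wn) w≢v
  ...   | s′ , pq = pruned-leaf⁺ kw (pruned-edge⁺ kw (pq-kept (pq-sym pq)) (inj₂ (r , pq))) only
    where
    kw : Kept w
    kw = leaf-kept l w≢v
    only : ∀ {y} → E′ w y → y ≡ s′
    only e′ with pruned-edge⁻ e′
    ... | _ , ky , inj₁ e        = ⊥-elim (proj₂ ky r (only-n e))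
    ... | _ , _  , inj₂ (_ , pq′) = pq-partner-unique pq′ pq

  -- The edge (x,y) of T appears as the edge (x′,y′) of the pruned tree; when u is contracted, its
  -- edge to s is represented by the new edge from the other neighbour s′ to s.
  data Image : V → V → V → V → Set where
    kept       : ∀ {x y} → Kept x → Kept y → Image x y x y
    contracted : ∀ {s s′} → removesU ≡ true → PQ s s′ → Image u s s′ s
    flipped    : ∀ {x y x′ y′} → Image x y x′ y′ → Image y x y′ x′

  image-of-edge : ∀ {x y} → E x y → x ≢ v → y ≢ v → ∃ λ x′ → ∃ λ y′ → Image x y x′ y′ × E′ x′ y′
  image-of-edge {x} {y} e x≢v y≢v with kept-or-removed x | kept-or-removed y
  ... | inj₁ kx              | inj₁ ky         = x , y , kept kx ky , pruned-edge⁺ kx ky (inj₁ e)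
  ... | inj₂ (inj₁ x≡v)      | _               = ⊥-elim (x≢v x≡v)
  ... | _                    | inj₂ (inj₁ y≡v) = ⊥-elim (y≢v y≡v)
  ... | inj₂ (inj₂ (r , refl)) | _ with partner r e y≢v
  ...   | s′ , pq = s′ , y , contracted r pq
                  , pruned-edge⁺ (pq-kept (pq-sym pq)) (pq-kept pq) (inj₂ (r , pq-sym pq))
  image-of-edge {x} {y} e x≢v y≢v | inj₁ _ | inj₂ (inj₂ (r , refl)) with partner r (edge-sym e) x≢v
  ...   | s′ , pq = x , s′ , flipped (contracted r pq)
                  , pruned-edge⁺ (pq-kept pq) (pq-kept (pq-sym pq)) (inj₂ (r , pq))

  preimage-of-edge : ∀ {x′ y′} → E′ x′ y′ → ∃ λ x → ∃ λ y → E x y × x ≢ v × y ≢ v × Image x y x′ y′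
  preimage-of-edge {x′} {y′} e′ with pruned-edge⁻ e′
  ... | kx , ky , inj₁ e        = x′ , y′ , e , proj₁ kx , proj₁ ky , kept kx ky
  ... | _  , _  , inj₂ (r , pq) = u , y′ , pq-edge (pq-sym pq) , edge⇒≢ uv , pq-≢v (pq-sym pq)
                                , contracted r (pq-sym pq)

  pruned-step⇒reach : ∀ {x y x′ y′ a b} → Image x y x′ y′ → W′ x′ y′ a b → Reach (W x y) a b
  pruned-step⇒reach (kept kx ky) (e′ , ¬xy) with pruned-edge⁻ e′
  ... | _ , _ , inj₁ e        = there (e , ¬xy) here
  ... | _ , _ , inj₂ (r , pq) =
    there (edge-sym (pq-edge pq) , [ proj₂ ky r ∘ sym ∘ proj₂ , proj₂ kx r ∘ sym ∘ proj₂ ])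
      (there (pq-edge (pq-sym pq) , [ proj₂ kx r ∘ sym ∘ proj₁ , proj₂ ky r ∘ sym ∘ proj₁ ]) here)
  pruned-step⇒reach (contracted r pq) (e′ , ¬s′s) with pruned-edge⁻ e′
  ... | ka , kb , inj₁ e       = there (avoiding⇒without _ e (proj₂ ka r) (proj₂ kb r)) here
  ... | _  , _  , inj₂ (_ , pq′) = ⊥-elim (¬s′s (Sum.swap (pq-same-pair pq pq′)))
  pruned-step⇒reach (flipped i) st = flip-side (pruned-step⇒reach i (without-flip P st))

  image-ends : ∀ {x y x′ y′} → Image x y x′ y′ → Reach (W x y) x x′ × Reach (W x y) y y′
  image-ends (kept _ _)        = here , here
  image-ends (contracted _ pq) =
    there (pq-edge (pq-sym pq) , [ pq-≢ (pq-sym pq) ∘ proj₂ , edge⇒≢ (pq-edge pq) ∘ proj₁ ]) here , here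
  image-ends (flipped i)       = let x⇝x′ , y⇝y′ = image-ends i in flip-side y⇝y′ , flip-side x⇝x′

  pruned-side⇒side : ∀ {x y x′ y′ w} → Image x y x′ y′ → Side P x′ y′ w → Side T x y w
  pruned-side⇒side i s = proj₁ (image-ends i) ◅◅ reach-gmap (λ z → z) (pruned-step⇒reach i) s

  u′ : V
  u′ = if removesU then p else u

  u′-contracted : removesU ≡ true → u′ ≡ p
  u′-contracted r rewrite r = refl

  -- Removed vertices are sent to a kept vertex on the same side of the edge.
  substitute : ∀ {x y x′ y′} → Image x y x′ y′ → V
  substitute (kept _ _)                 = u′
  substitute (contracted {s′ = s′} _ _) = s′
  substitute (flipped i)                = substitute i

  collapse : V → V → V
  collapse c z = [ (λ _ → z) , (λ _ → c) ] (kept-or-removed z)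

  collapse-kept : ∀ {c z} → Kept z → collapse c z ≡ z
  collapse-kept {z = z} kz with kept-or-removed z
  ... | inj₁ _  = refl
  ... | inj₂ rz = ⊥-elim (kept-not-removed kz rz)

  collapse-removed : ∀ {c z} → Removed z → collapse c z ≡ c
  collapse-removed {z = z} rz with kept-or-removed z
  ... | inj₁ kz = ⊥-elim (kept-not-removed kz rz)
  ... | inj₂ _  = refl

  collapse-ends : ∀ {x y x′ y′} (i : Image x y x′ y′)
                → collapse (substitute i) x ≡ x′ × collapse (substitute i) y ≡ y′
  collapse-ends (kept kx ky)      = collapse-kept kx , collapse-kept ky
  collapse-ends (contracted r pq) = collapse-removed (inj₂ (r , refl)) , collapse-kept (pq-kept pq)
  collapse-ends (flipped i)       = Product.swap (collapse-ends i)

  substitute-u-kept : ∀ {x y x′ y′} (i : Image x y x′ y′) → Kept u → substitute i ≡ u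
  substitute-u-kept (kept _ _) (_ , u≢u) with removesU
  ... | true  = ⊥-elim (u≢u refl refl)
  ... | false = refl
  substitute-u-kept (contracted r _) (_ , u≢u) = ⊥-elim (u≢u r refl)
  substitute-u-kept (flipped i) ku = substitute-u-kept i ku

  kept-step : ∀ {x y x′ y′ a b} → Image x y x′ y′ → Kept a → Kept b → W x y a b → W′ x′ y′ a b
  kept-step (kept _ _) ka kb (e , ¬xy) = pruned-edge⁺ ka kb (inj₁ e) , ¬xy
  kept-step (contracted _ pq) ka kb (e , _) = pruned-edge⁺ ka kb (inj₁ e) , λ where
    (inj₁ (refl , refl)) → pq-no-edge (pq-sym pq) e
    (inj₂ (refl , refl)) → pq-no-edge pq e
  kept-step (flipped i) ka kb st = without-flip P (kept-step i ka kb (without-flip T st))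

  substitute-reaches : ∀ {x y x′ y′ b} → E x y → (i : Image x y x′ y′) → removesU ≡ true
                     → Kept b → W x y u b → Reach (W′ x′ y′) (substitute i) b
  substitute-reaches {x} {y} {b = b} exy (kept _ _) r kb (ub , _) =
    subst (λ c → Reach (W′ x y) c b) (sym (u′-contracted r)) (from-p (partner r ub (proj₁ kb)))
    where
    from-p : ∃ (PQ b) → Reach (W′ x y) p b
    from-p (_ , pq@(inj₁ (refl , refl))) = here
    from-p (_ , pq@(inj₂ (refl , refl))) =
      there (pruned-edge⁺ (pq-kept (pq-sym pq)) kb (inj₂ (r , pq-sym pq)) , λ where
               (inj₁ (refl , refl)) → pq-no-edge (pq-sym pq) exy
               (inj₂ (refl , refl)) → pq-no-edge pq exy)
            here
  substitute-reaches exy (contracted _ pq) r kb (ub , ¬us) with partner r ub (proj₁ kb)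
  ... | _ , pqb with pq-same-pair pq pqb
  ...   | inj₁ (refl , _) = ⊥-elim (¬us (inj₁ (refl , refl)))
  ...   | inj₂ (refl , _) = here
  substitute-reaches exy (flipped i) r kb st =
    reach-map (without-flip P) (substitute-reaches (edge-sym exy) i r kb (without-flip T st))

  removed-kept-step : ∀ {x y x′ y′ a b} → E x y → (i : Image x y x′ y′)
                    → Removed a → Kept b → W x y a b → Reach (W′ x′ y′) (substitute i) b
  removed-kept-step exy i (inj₁ refl) kb (e , _) with v-neighbour e
  ... | refl rewrite substitute-u-kept i kb = here
  removed-kept-step exy i (inj₂ (r , refl)) kb st = substitute-reaches exy i r kb st

  step⇒pruned-reach : ∀ {x y x′ y′ a b} → E x y → (i : Image x y x′ y′) → W x y a b
                    → Reach (W′ x′ y′) (collapse (substitute i) a) (collapse (substitute i) b)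
  step⇒pruned-reach {a = a} {b} exy i st with kept-or-removed a | kept-or-removed b
  ... | inj₁ ka | inj₁ kb = there (kept-step i ka kb st) here
  ... | inj₂ _  | inj₂ _  = here
  ... | inj₂ ra | inj₁ kb = removed-kept-step exy i ra kb st
  ... | inj₁ ka | inj₂ rb =
    reach-reverse (without-sym P pruned-edge-sym) (removed-kept-step exy i rb ka (without-sym T edge-sym st))

  side⇒pruned-side : ∀ {x y x′ y′ w} → E x y → Image x y x′ y′ → Side T x y w → Kept w → Side P x′ y′ w
  side⇒pruned-side exy i s kw =
    subst₂ (Reach _) (proj₁ (collapse-ends i)) (collapse-kept kw)
      (reach-gmap (collapse (substitute i)) (step⇒pruned-reach exy i) s)

  module _ (replace-v : ∀ {x y} → E x y → x ≢ v → y ≢ v → Side T x y v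
                      → ∃ λ w → Leaf T w × w ≢ v × Side T x y w × ψ w ≡ ψ v) where

    label⇒pruned-label : ∀ {x y x′ y′ m} → E x y → x ≢ v → y ≢ v → Image x y x′ y′
                       → LabelOnSide T x y m → LabelOnSide P x′ y′ m
    label⇒pruned-label exy x≢v y≢v i (w , lw , sw , ψw) with w ≟V v
    ... | no w≢v = w , leaf⇒pruned-leaf lw w≢v , side⇒pruned-side exy i sw (leaf-kept lw w≢v) , ψw
    ... | yes refl with replace-v exy x≢v y≢v sw
    ...   | w′ , lw′ , w′≢v , sw′ , ψw′ =
      w′ , leaf⇒pruned-leaf lw′ w′≢v , side⇒pruned-side exy i sw′ (leaf-kept lw′ w′≢v) , trans ψw′ ψw

    pruned-label⇒label : ∀ {x y x′ y′ m} → Image x y x′ y′ → LabelOnSide P x′ y′ m → LabelOnSide T x y m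
    pruned-label⇒label i (w , lw , sw , ψw) = w , proj₁ (pruned-leaf⇒leaf lw) , pruned-side⇒side i sw , ψw

    InM⇒pruned : ∀ {x y x′ y′ m} → E x y → x ≢ v → y ≢ v → Image x y x′ y′ → InM T x y m → InM P x′ y′ m
    InM⇒pruned exy x≢v y≢v i (near , ¬far) =
      label⇒pruned-label exy x≢v y≢v i near , ¬far ∘ pruned-label⇒label (flipped i)

    pruned-InM⇒InM : ∀ {x y x′ y′ m} → E x y → x ≢ v → y ≢ v → Image x y x′ y′ → InM P x′ y′ m → InM T x y m
    pruned-InM⇒InM exy x≢v y≢v i (near , ¬far) =
      pruned-label⇒label i near , ¬far ∘ label⇒pruned-label (edge-sym exy) y≢v x≢v (flipped i)

    InM-at-v : ∀ {y m} → E v y → InM T v y m → m ≡ ψ v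
    InM-at-v e ((w , _ , sw , ψw) , _) with leaf-side leaf-v e sw
    ... | refl = sym ψw

    quartet⇒pruned : ∀ {x y a b c d} → a ≢ b → c ≢ d → InΔ T x y a b c d
                   → ∃ λ x′ → ∃ λ y′ → InΔ P x′ y′ a b c d
    quartet⇒pruned {x} {y} a≢b c≢d (exy , ma , mb , mc , md) with x ≟V v | y ≟V v
    ... | yes refl | _ = ⊥-elim (a≢b (trans (InM-at-v exy ma) (sym (InM-at-v exy mb))))
    ... | no _ | yes refl =
      ⊥-elim (c≢d (trans (InM-at-v (edge-sym exy) mc) (sym (InM-at-v (edge-sym exy) md))))
    ... | no x≢v | no y≢v with image-of-edge exy x≢v y≢v
    ...   | x′ , y′ , i , e′ =
      x′ , y′ , e′ , InM⇒pruned exy x≢v y≢v i ma , InM⇒pruned exy x≢v y≢v i mb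
                   , InM⇒pruned (edge-sym exy) y≢v x≢v (flipped i) mc
                   , InM⇒pruned (edge-sym exy) y≢v x≢v (flipped i) md

    pruned-quartet⇒ : ∀ {x′ y′ a b c d} → InΔ P x′ y′ a b c d → ∃ λ x → ∃ λ y → InΔ T x y a b c d
    pruned-quartet⇒ (e′ , ma , mb , mc , md) with preimage-of-edge e′
    ... | x , y , exy , x≢v , y≢v , i =
      x , y , exy , pruned-InM⇒InM exy x≢v y≢v i ma , pruned-InM⇒InM exy x≢v y≢v i mb
                  , pruned-InM⇒InM (edge-sym exy) y≢v x≢v (flipped i) mc
                  , pruned-InM⇒InM (edge-sym exy) y≢v x≢v (flipped i) md

    pruning-preserves-information : SameInfo T P
    pruning-preserves-information a b c d = mk⇔ to from
      where
      to : InI T a b c d → InI P a b c d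
      to (a≢b , a≢c , a≢d , b≢c , b≢d , c≢d , _ , _ , δ) =
        a≢b , a≢c , a≢d , b≢c , b≢d , c≢d , quartet⇒pruned a≢b c≢d δ
      from : InI P a b c d → InI T a b c d
      from (a≢b , a≢c , a≢d , b≢c , b≢d , c≢d , _ , _ , δ) =
        a≢b , a≢c , a≢d , b≢c , b≢d , c≢d , pruned-quartet⇒ δ

lemma5 : {L : Set} (T : Graph L) → IsMULTree T → (ℓ : L)
       → (∃ λ w₁ → ∃ λ w₂ → w₁ ≢ w₂ × Leaf T w₁ × Leaf T w₂
            × Graph.ψ T w₁ ≡ ℓ × Graph.ψ T w₂ ≡ ℓ)
       → (v u : Graph.V T) → Leaf T v → Graph.ψ T v ≡ ℓ → Edge T u v
       → Pendant T u → SpanDeg≥3 T ℓ u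
       → Prunable T v
-- The hypotheses that ℓ labels two leaves and that u is pendant follow from the others.
lemma5 T isT ℓ _ v u leaf-v ψv≡ℓ uv _ (_ , _ , _ , ≢₁₂ , ≢₁₃ , ≢₂₃ , e₁ , e₂ , e₃ , _ , s₁ , s₂ , s₃)
  with WithDecidableEquality.two-distinct-avoiding (Graph._≟V_ T) v ≢₁₂ ≢₁₃ ≢₂₃ (e₁ , s₁) (e₂ , s₂) (e₃ , s₃)
... | p , q , p≢q , p≢v , q≢v , (up , span-p) , (uq , span-q) =
  leaf-v , subst (SameInfo T) (sym (prune-leaf leaf-v uv))
             (pruning-preserves-information (label-recurs uv up uq p≢q p≢v q≢v span-p span-q ψv≡ℓ))
  where
  open MULTree T isT
  open Pruning T isT leaf-v uv up uq p≢q p≢v q≢v
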